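{- Let $S$ and $T$ be numerical semigroups such that $\mathrm H_S(x^w)f(x)=\mathrm H_T(x)$ for some positive integer $w$ and some polynomial $f\in\mathbb N[x]$. Let $u$ be the greatest common divisor of the exponents of the monomials of $f$ (with nonzero coefficient). If $u\in S$, then there exists a numerical semigroup $U$ such that $T=uU+_{uw}wS$.
   Context: A numerical semigroup is a submonoid of $(\mathbb N,+)$ with finite complement; its Hilbert series is $\mathrm H_S(x)=\sum_{s\in S}x^s$. For $c\in\mathbb N$, $cS=\{cs\mid s\in S\}$. For submonoids $T,T_1,T_2$ of $\mathbb N$, $T=T_1+_dT_2$ (a gluing) means $d=\mathrm{lcm}(\gcd(T_1),\gcd(T_2))$, $T=T_1+T_2=\{t_1+t_2\mid t_i\in T_i\}$ and $d\in T_1\cap T_2$. -}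

module Defs where

open import Data.Nat using (ℕ; zero; suc; _+_; _*_; _∸_; _≤_; _≡ᵇ_)
open import Data.Nat.GCD using (gcd)
open import Data.Nat.LCM using (lcm)
open import Data.Nat.Divisibility using (_∣_)
open import Data.Bool using (Bool; true; false; if_then_else_; _∧_)
open import Data.List using (List; []; _∷_; map; upTo)
open import Data.Nat.ListAction using (sum)
open import Data.Product using (_×_; ∃-syntax; Σ-syntax)
open import Relation.Binary.PropositionalEquality using (_≡_)

_∈ₛ_ : ℕ → (ℕ → Bool) → Set
n ∈ₛ S = S n ≡ true

record IsNumericalSemigroup (S : ℕ → Bool) : Set where
  field
    zero∈    : 0 ∈ₛ S
    closed   : ∀ a b → a ∈ₛ S → b ∈ₛ S → (a + b) ∈ₛ S
    cofinite : ∃[ N ] (∀ n → N ≤ n → n ∈ₛ S)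

-- Polynomials in ℕ[x] as coefficient lists [f₀, f₁, …].
coeff : List ℕ → ℕ → ℕ
coeff []       _       = 0
coeff (a ∷ _)  zero    = a
coeff (_ ∷ as) (suc j) = coeff as j

-- Coefficient of x^n in H_S(x) = Σ_{s ∈ S} x^s.
hilbCoeff : (ℕ → Bool) → ℕ → ℕ
hilbCoeff S n = if S n then 1 else 0

-- Coefficient of x^a in H_S(x^w) = Σ_{s ∈ S} x^{w s}:
-- number of k ∈ S with w * k = a (for w ≥ 1 such k satisfy k ≤ a).
hilbPowCoeff : (ℕ → Bool) → ℕ → ℕ → ℕ
hilbPowCoeff S w a = sum (map (λ k → if S k ∧ (w * k ≡ᵇ a) then 1 else 0) (upTo (suc a)))

-- Coefficient of x^n in H_S(x^w) · f(x) (Cauchy product).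
hilbProdCoeff : (ℕ → Bool) → ℕ → List ℕ → ℕ → ℕ
hilbProdCoeff S w f n = sum (map (λ b → hilbPowCoeff S w (n ∸ b) * coeff f b) (upTo (suc n)))

-- gcd of the exponents of the monomials of f with nonzero coefficient
-- (gcd of the empty family is 0, gcd(0, m) = m).
expGcdFrom : ℕ → List ℕ → ℕ
expGcdFrom _ []       = 0
expGcdFrom j (a ∷ as) = if a ≡ᵇ 0 then expGcdFrom (suc j) as else gcd j (expGcdFrom (suc j) as)

expGcd : List ℕ → ℕ
expGcd f = expGcdFrom 0 f

asPred : (ℕ → Bool) → ℕ → Set
asPred S n = n ∈ₛ S

scale : ℕ → (ℕ → Bool) → ℕ → Set
scale c S n = ∃[ s ] (s ∈ₛ S × n ≡ c * s)

IsGcdOf : (ℕ → Set) → ℕ → Set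
IsGcdOf P g = (∀ n → P n → g ∣ n) × (∀ d → (∀ n → P n → d ∣ n) → d ∣ g)

IsGluing : (T T₁ T₂ : ℕ → Set) → ℕ → Set
IsGluing T T₁ T₂ d =
  (∃[ g₁ ] ∃[ g₂ ] (IsGcdOf T₁ g₁ × IsGcdOf T₂ g₂ × d ≡ lcm g₁ g₂))
  × (∀ n → T n → ∃[ a ] ∃[ b ] (T₁ a × T₂ b × n ≡ a + b))
  × (∀ a b → T₁ a → T₂ b → T (a + b))
  × T₁ d × T₂ d

{-# OPTIONS --safe #-}
module Submission where

-- Reading H_S(x^w) f(x) = H_T(x) coefficientwise, n ∈ T exactly when n = b + w k with
-- f_b > 0 and k ∈ S.  Taking n = 0 gives f_0 > 0, hence wS ⊆ T; taking k = 0 gives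
-- supp f ⊆ T.  Since u divides every b in supp f, gcd(u, w) divides every element of T,
-- and two consecutive elements of T force gcd(u, w) = 1, so lcm(u, w) = u w.  With
-- U = {n | u n ∈ T} every b ∈ supp f lies in uU, which yields T = uU + wS; finally
-- u w ∈ uU because w u ∈ wS ⊆ T, and u w ∈ wS because u ∈ S.

open import Defs
open import Data.Nat using (ℕ; zero; suc; _+_; _*_; _∸_; _≤_; _<_; _≡ᵇ_; z≤n; s≤s; s≤s⁻¹; >-nonZero)
open import Data.Nat.Properties
open import Data.Nat.GCD using (gcd; gcd[m,n]∣m; gcd[m,n]∣n)
open import Data.Nat.LCM using (lcm; gcd*lcm)
open import Data.Nat.Divisibility using (_∣_; divides; ∣-trans; ∣m∣n⇒∣m+n; ∣m+n∣m⇒∣n; ∣1⇒≡1; m∣m*n)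
open import Data.Bool using (Bool; true; false; if_then_else_; _∧_; T)
open import Data.List using (List; []; _∷_; map; upTo)
open import Data.Nat.ListAction using (sum)
open import Data.List.Membership.Propositional using (_∈_)
open import Data.List.Membership.Propositional.Properties using (∈-upTo⁺; ∈-upTo⁻)
open import Data.List.Relation.Unary.Any using (here; there)
open import Data.Product using (_×_; ∃-syntax; _,_)
open import Data.Empty using (⊥-elim)
open import Relation.Binary.PropositionalEquality

m*n>0⇒m>0 : ∀ m {n} → 0 < m * n → 0 < m
m*n>0⇒m>0 (suc m) _ = s≤s z≤n

m*n>0⇒n>0 : ∀ m {n} → 0 < m * n → 0 < n
m*n>0⇒n>0 m {n} m*n>0 = m*n>0⇒m>0 n (subst (0 <_) (*-comm m n) m*n>0)

m>0∧n>0⇒m*n>0 : ∀ {m n} → 0 < m → 0 < n → 0 < m * n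
m>0∧n>0⇒m*n>0 {suc m} {suc n} _ _ = s≤s z≤n

∈⇒≤sum-map : (g : ℕ → ℕ) {xs : List ℕ} {x : ℕ} → x ∈ xs → g x ≤ sum (map g xs)
∈⇒≤sum-map g {y ∷ _} (here refl) = m≤m+n (g y) _
∈⇒≤sum-map g {y ∷ _} (there x∈ys) = ≤-trans (∈⇒≤sum-map g x∈ys) (m≤n+m _ (g y))

sum-map>0⇒∃ : (g : ℕ → ℕ) (xs : List ℕ) → 0 < sum (map g xs) → ∃[ x ] (x ∈ xs × 0 < g x)
sum-map>0⇒∃ g (y ∷ ys) sum>0 with g y in gy≡
... | suc _ = y , here refl , subst (0 <_) (sym gy≡) (s≤s z≤n)
... | zero with sum-map>0⇒∃ g ys sum>0
...   | x , x∈ys , gx>0 = x , there x∈ys , gx>0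

∣n∧∣1+n⇒≡1 : ∀ {d n} → d ∣ n → d ∣ suc n → d ≡ 1
∣n∧∣1+n⇒≡1 {d} {n} d∣n d∣1+n = ∣1⇒≡1 (∣m+n∣m⇒∣n (subst (d ∣_) (+-comm 1 n) d∣1+n) d∣n)

gcd≡1⇒lcm≡* : ∀ m n → gcd m n ≡ 1 → lcm m n ≡ m * n
gcd≡1⇒lcm≡* m n gcd≡1 = begin
  lcm m n            ≡⟨ *-identityˡ (lcm m n) ⟨
  1 * lcm m n        ≡⟨ cong (_* lcm m n) gcd≡1 ⟨
  gcd m n * lcm m n  ≡⟨ gcd*lcm m n ⟩
  m * n              ∎
  where open ≡-Reasoning

Cofinite : (ℕ → Bool) → Set
Cofinite S = ∃[ N ] (∀ n → N ≤ n → n ∈ₛ S)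

common-divisor-of-cofinite≡1 : ∀ {S d} → Cofinite S → (∀ n → n ∈ₛ S → d ∣ n) → d ≡ 1
common-divisor-of-cofinite≡1 (N , cof) d∣S =
  ∣n∧∣1+n⇒≡1 (d∣S N (cof N ≤-refl)) (d∣S (suc N) (cof (suc N) (n≤1+n N)))

scale-IsGcdOf : ∀ c {V} → Cofinite V → IsGcdOf (scale c V) c
scale-IsGcdOf c {V} (N , cof) = c∣cV , greatest
  where
  c∣cV : ∀ n → scale c V n → c ∣ n
  c∣cV n (s , _ , refl) = m∣m*n s

  greatest : ∀ d → (∀ n → scale c V n → d ∣ n) → d ∣ c
  greatest d d∣cV = ∣m+n∣m⇒∣n (subst (d ∣_) c[1+N]≡cN+c d∣c[1+N]) d∣cN
    where
    d∣cN = d∣cV (c * N) (N , cof N ≤-refl , refl)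
    d∣c[1+N] = d∣cV (c * suc N) (suc N , cof (suc N) (n≤1+n N) , refl)
    c[1+N]≡cN+c = trans (*-suc c N) (+-comm c (c * N))

quotient : ℕ → (ℕ → Bool) → ℕ → Bool
quotient u S n = S (u * n)

quotient-isNumericalSemigroup : ∀ u {S} → IsNumericalSemigroup S → IsNumericalSemigroup (quotient u S)
quotient-isNumericalSemigroup u {S} nsS = record
  { zero∈    = subst (_∈ₛ S) (sym (*-zeroʳ u)) zero∈
  ; closed   = λ a b a∈ b∈ → subst (_∈ₛ S) (sym (*-distribˡ-+ u a b)) (closed _ _ a∈ b∈)
  ; cofinite = quotient-cofinite u cofinite
  }
  where
  open IsNumericalSemigroup nsS

  quotient-cofinite : ∀ u → Cofinite S → Cofinite (quotient u S)
  quotient-cofinite zero    _         = 0 , λ _ _ → zero∈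
  quotient-cofinite (suc v) (N , cof) = N , λ n N≤n → cof (suc v * n) (≤-trans N≤n (m≤n*m n (suc v)))

expGcdFrom-∣ : ∀ i as j → 0 < coeff as j → expGcdFrom i as ∣ i + j
expGcdFrom-∣ i (suc a ∷ as) zero _ rewrite +-identityʳ i = gcd[m,n]∣m i _
expGcdFrom-∣ i (a ∷ as) (suc j) c>0 rewrite +-suc i j with a ≡ᵇ 0
... | true  = expGcdFrom-∣ (suc i) as j c>0
... | false = ∣-trans (gcd[m,n]∣n i _) (expGcdFrom-∣ (suc i) as j c>0)

expGcd-∣ : ∀ f b → 0 < coeff f b → expGcd f ∣ b
expGcd-∣ f = expGcdFrom-∣ 0 f

hilbCoeff>0⇒∈ : ∀ S n → 0 < hilbCoeff S n → n ∈ₛ S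
hilbCoeff>0⇒∈ S n c>0 with S n
... | true  = refl
... | false = ⊥-elim (<-irrefl refl c>0)

∈⇒hilbCoeff>0 : ∀ S n → n ∈ₛ S → 0 < hilbCoeff S n
∈⇒hilbCoeff>0 S n n∈S rewrite n∈S = s≤s z≤n

hilbPowCoeff>0⇒∈scale : ∀ S w a → 0 < hilbPowCoeff S w a → scale w S a
hilbPowCoeff>0⇒∈scale S w a c>0 with sum-map>0⇒∃ _ (upTo (suc a)) c>0
... | k , _ , term>0 with S k in k∈S | w * k ≡ᵇ a in wk≡ᵇa
...   | true  | true  = k , k∈S , sym (≡ᵇ⇒≡ (w * k) a (subst T (sym wk≡ᵇa) _))
...   | true  | false = ⊥-elim (<-irrefl refl term>0)
...   | false | _     = ⊥-elim (<-irrefl refl term>0)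

∈⇒hilbPowCoeff>0 : ∀ S w k → 0 < w → k ∈ₛ S → 0 < hilbPowCoeff S w (w * k)
∈⇒hilbPowCoeff>0 S w k w>0 k∈S =
  <-≤-trans term>0 (∈⇒≤sum-map (λ j → if S j ∧ (w * j ≡ᵇ w * k) then 1 else 0) k∈upTo)
  where
  k∈upTo : k ∈ upTo (suc (w * k))
  k∈upTo = ∈-upTo⁺ (s≤s (m≤n*m k w {{>-nonZero w>0}}))

  term>0 : 0 < (if S k ∧ (w * k ≡ᵇ w * k) then 1 else 0)
  term>0 rewrite k∈S with w * k ≡ᵇ w * k | ≡⇒≡ᵇ (w * k) (w * k) refl
  ... | true | _ = s≤s z≤n

InSupport+Scale : List ℕ → ℕ → (ℕ → Bool) → ℕ → Set
InSupport+Scale f w S n = ∃[ b ] ∃[ k ] (0 < coeff f b × k ∈ₛ S × n ≡ b + w * k)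

hilbProdCoeff>0⇒InSupport+Scale : ∀ S w f n → 0 < hilbProdCoeff S w f n → InSupport+Scale f w S n
hilbProdCoeff>0⇒InSupport+Scale S w f n c>0
  with b , b∈upTo , term>0 ← sum-map>0⇒∃ (λ j → hilbPowCoeff S w (n ∸ j) * coeff f j) (upTo (suc n)) c>0
  with k , k∈S , n∸b≡wk ← hilbPowCoeff>0⇒∈scale S w (n ∸ b) (m*n>0⇒m>0 _ term>0)
  = b , k , m*n>0⇒n>0 (hilbPowCoeff S w (n ∸ b)) term>0 , k∈S , n≡b+wk
  where
  open ≡-Reasoning
  n≡b+wk : n ≡ b + w * k
  n≡b+wk = begin
    n            ≡⟨ m+[n∸m]≡n (s≤s⁻¹ (∈-upTo⁻ b∈upTo)) ⟨
    b + (n ∸ b)  ≡⟨ cong (b +_) n∸b≡wk ⟩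
    b + w * k    ∎

InSupport+Scale⇒hilbProdCoeff>0 : ∀ S w f n → 0 < w → InSupport+Scale f w S n → 0 < hilbProdCoeff S w f n
InSupport+Scale⇒hilbProdCoeff>0 S w f n w>0 (b , k , fb>0 , k∈S , refl) =
  <-≤-trans term>0 (∈⇒≤sum-map (λ j → hilbPowCoeff S w (b + w * k ∸ j) * coeff f j) b∈upTo)
  where
  b∈upTo : b ∈ upTo (suc (b + w * k))
  b∈upTo = ∈-upTo⁺ (s≤s (m≤m+n b (w * k)))

  term>0 : 0 < hilbPowCoeff S w (b + w * k ∸ b) * coeff f b
  term>0 rewrite m+n∸m≡n b (w * k) = m>0∧n>0⇒m*n>0 (∈⇒hilbPowCoeff>0 S w k w>0 k∈S) fb>0

module HilbertFactorisation
  (S T : ℕ → Bool) (nsS : IsNumericalSemigroup S) (nsT : IsNumericalSemigroup T)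
  (w : ℕ) (w>0 : 0 < w) (f : List ℕ) (H : ∀ n → hilbProdCoeff S w f n ≡ hilbCoeff T n)
  where

  private
    module S = IsNumericalSemigroup nsS
    module T = IsNumericalSemigroup nsT

  ∈T⇒InSupport+Scale : ∀ n → n ∈ₛ T → InSupport+Scale f w S n
  ∈T⇒InSupport+Scale n n∈T =
    hilbProdCoeff>0⇒InSupport+Scale S w f n (subst (0 <_) (sym (H n)) (∈⇒hilbCoeff>0 T n n∈T))

  InSupport+Scale⇒∈T : ∀ n → InSupport+Scale f w S n → n ∈ₛ T
  InSupport+Scale⇒∈T n d =
    hilbCoeff>0⇒∈ T n (subst (0 <_) (H n) (InSupport+Scale⇒hilbProdCoeff>0 S w f n w>0 d))

  coeff₀>0 : 0 < coeff f 0
  coeff₀>0 with b , _ , fb>0 , _ , 0≡b+wk ← ∈T⇒InSupport+Scale 0 T.zero∈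
    rewrite m+n≡0⇒m≡0 b (sym 0≡b+wk) = fb>0

  scale⊆T : ∀ k → k ∈ₛ S → (w * k) ∈ₛ T
  scale⊆T k k∈S = InSupport+Scale⇒∈T (w * k) (0 , k , coeff₀>0 , k∈S , refl)

  support⊆T : ∀ b → 0 < coeff f b → b ∈ₛ T
  support⊆T b fb>0 = InSupport+Scale⇒∈T b (b , 0 , fb>0 , S.zero∈ , sym b+w0≡b)
    where
    b+w0≡b : b + w * 0 ≡ b
    b+w0≡b = trans (cong (b +_) (*-zeroʳ w)) (+-identityʳ b)

  gcd[expGcd,w]≡1 : gcd (expGcd f) w ≡ 1
  gcd[expGcd,w]≡1 = common-divisor-of-cofinite≡1 T.cofinite gcd∣T
    where
    gcd∣T : ∀ n → n ∈ₛ T → gcd (expGcd f) w ∣ n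
    gcd∣T n n∈T with b , k , fb>0 , _ , refl ← ∈T⇒InSupport+Scale n n∈T =
      ∣m∣n⇒∣m+n (∣-trans (gcd[m,n]∣m (expGcd f) w) (expGcd-∣ f b fb>0)) (∣-trans (gcd[m,n]∣n (expGcd f) w) (m∣m*n {w} k))

  ∈T⇒∈sum : ∀ n → n ∈ₛ T →
            ∃[ a ] ∃[ c ] (scale (expGcd f) (quotient (expGcd f) T) a × scale w S c × n ≡ a + c)
  ∈T⇒∈sum n n∈T
    with b , k , fb>0 , k∈S , n≡b+wk ← ∈T⇒InSupport+Scale n n∈T
    with divides q b≡qu ← expGcd-∣ f b fb>0
    = b , w * k , (q , subst (_∈ₛ T) b≡uq (support⊆T b fb>0) , b≡uq) , (k , k∈S , refl) , n≡b+wk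
    where
    b≡uq : b ≡ expGcd f * q
    b≡uq = trans b≡qu (*-comm q (expGcd f))

mainTheorem8 : (S T : ℕ → Bool) → IsNumericalSemigroup S → IsNumericalSemigroup T →
               (w : ℕ) → 0 < w → (f : List ℕ) →
               (∀ n → hilbProdCoeff S w f n ≡ hilbCoeff T n) →
               expGcd f ∈ₛ S →
               ∃[ U ] (IsNumericalSemigroup U ×
                 IsGluing (asPred T) (scale (expGcd f) U) (scale w S) (expGcd f * w))
mainTheorem8 S T nsS nsT w w>0 f H u∈S =
  U , nsU ,
  ( (u , w , scale-IsGcdOf u (IsNumericalSemigroup.cofinite nsU) ,
             scale-IsGcdOf w (IsNumericalSemigroup.cofinite nsS) ,
             sym (gcd≡1⇒lcm≡* u w gcd[expGcd,w]≡1))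
  , ∈T⇒∈sum
  , (λ { _ _ (q , uq∈T , refl) (k , k∈S , refl) → IsNumericalSemigroup.closed nsT _ _ uq∈T (scale⊆T k k∈S) })
  , (w , subst (_∈ₛ T) (*-comm w u) (scale⊆T u u∈S) , refl)
  , (u , u∈S , *-comm u w) )
  where
  open HilbertFactorisation S T nsS nsT w w>0 f H
  u = expGcd f
  U = quotient u T
  nsU = quotient-isNumericalSemigroup u nsT
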